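{- Let $s\in\mathcal{S}_n$ and let $d_1<d_2$ be non-negative integers. If $N_n^{d_1}(s)$ contains a subset $X$ with $|X|=x$ such that every two distinct sequences in $X$ have edit distance at least $d_2$, then every $(d_1,d_2)$-sensitive bucketing function $f$ on $\mathcal{S}_n$ satisfies $|f(s)|\ge x$.
   Context: $\Sigma$ is a finite alphabet with $|\Sigma|>1$, $n\ge1$, and $\mathcal{S}_n=\Sigma^n$ with the edit (Levenshtein) distance $\mathrm{edit}$. $N_n^d(s)=\{t\in\mathcal{S}_n:\mathrm{edit}(s,t)\le d\}$. A bucketing function with bucket set $B$ is a map $f:\mathcal{S}_n\to\mathcal{P}(B)$; it is $(d_1,d_2)$-sensitive if for all $s,t\in\mathcal{S}_n$: $\mathrm{edit}(s,t)\le d_1\Rightarrow f(s)\cap f(t)\neq\emptyset$ and $\mathrm{edit}(s,t)\ge d_2\Rightarrow f(s)\cap f(t)=\emptyset$. -}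

module Defs where

open import Data.Nat using (ℕ; zero; suc; _≤_; _<_; _⊔_; _⊓_; _+_)
open import Data.Fin using (Fin)
open import Data.Fin.Properties using (_≟_)
open import Data.List using (List; []; _∷_; length)
open import Data.Vec using (Vec; toList)
open import Data.Product using (Σ; ∃; _×_)
open import Relation.Nullary using (¬_; yes; no)

cost : ∀ {k} → Fin k → Fin k → ℕ
cost x y with x ≟ y
... | yes _ = 0
... | no  _ = 1

editL : ∀ {k} → List (Fin k) → List (Fin k) → ℕ
editL [] ys = length ys
editL (x ∷ xs) [] = length (x ∷ xs)
editL (x ∷ xs) (y ∷ ys) =
  suc (editL xs (y ∷ ys)) ⊓ suc (editL (x ∷ xs) ys) ⊓ (cost x y + editL xs ys)

S : ℕ → ℕ → Set
S k n = Vec (Fin k) n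

edit : ∀ {k n} → S k n → S k n → ℕ
edit s t = editL (toList s) (toList t)

InBall : ∀ {k n} → ℕ → S k n → S k n → Set
InBall d s t = edit s t ≤ d

-- A bucketing function with bucket set B: f s is a subset of B (a predicate).
Bucketing : ℕ → ℕ → Set → Set₁
Bucketing k n B = S k n → B → Set

Meets : ∀ {k n} {B : Set} → Bucketing k n B → S k n → S k n → Set
Meets {B = B} f s t = Σ B (λ b → f s b × f t b)

Sensitive : ∀ {k n} {B : Set} → ℕ → ℕ → Bucketing k n B → Set
Sensitive d₁ d₂ f =
  (∀ s t → edit s t ≤ d₁ → Meets f s t) ×
  (∀ s t → d₂ ≤ edit s t → ¬ Meets f s t)

{-# OPTIONS --safe #-}
module Submission where

-- Each X i lies within d₁ of s, so it shares a bucket g i with s; two distinct X i, X j are at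
-- least d₂ apart, so they share no bucket, hence g is injective and f s has at least x buckets.

open import Defs
open import Data.Nat using (ℕ; _≤_; _<_)
open import Data.Fin using (Fin)
open import Data.Fin.Properties using (_≟_)
open import Data.Product using (Σ; _×_; _,_; proj₁; proj₂)
open import Relation.Nullary using (¬_; yes; no; contradiction)
open import Relation.Binary.PropositionalEquality using (_≡_; _≢_; subst; sym)
open import Function.Definitions using (Injective)

far⇒disjointBuckets : ∀ {k n d₁ d₂} {B : Set} {f : Bucketing k n B} → Sensitive d₁ d₂ f →
                      ∀ {t u b} → d₂ ≤ edit t u → f t b → ¬ f u b
far⇒disjointBuckets (_ , far) {t} {u} {b} d₂≤tu b∈ft b∈fu = far t u d₂≤tu (b , b∈ft , b∈fu)

lemma1 : (k : ℕ) → 2 ≤ k → (n : ℕ) → 1 ≤ n → (s : S k n) → (d₁ d₂ : ℕ) → d₁ < d₂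
    → (x : ℕ) → (X : Fin x → S k n) → Injective _≡_ _≡_ X
    → (∀ i → InBall d₁ s (X i))
    → (∀ i j → X i ≢ X j → d₂ ≤ edit (X i) (X j))
    → (B : Set) → (f : Bucketing k n B) → Sensitive d₁ d₂ f
    → Σ (Fin x → B) (λ g → Injective _≡_ _≡_ g × (∀ i → f s (g i)))
lemma1 k _ n _ s d₁ d₂ _ x X X-inj ball separated B f sensitive = g , g-inj , g∈fs
  where
  meets : ∀ i → Meets f s (X i)
  meets i = proj₁ sensitive s (X i) (ball i)

  g : Fin x → B
  g i = proj₁ (meets i)

  g∈fs : ∀ i → f s (g i)
  g∈fs i = proj₁ (proj₂ (meets i))

  g∈fX : ∀ i → f (X i) (g i)
  g∈fX i = proj₂ (proj₂ (meets i))

  g-inj : Injective _≡_ _≡_ g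
  g-inj {i} {j} gi≡gj with i ≟ j
  ... | yes i≡j = i≡j
  ... | no  i≢j = contradiction (subst (f (X j)) (sym gi≡gj) (g∈fX j))
                    (far⇒disjointBuckets sensitive
                       (separated i j (λ Xi≡Xj → i≢j (X-inj Xi≡Xj))) (g∈fX i))
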